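{- Suppose there exists a $(K',F',Z',S')$-PDA $\mathcal{P}'$, and write $Z'=F'-g'$. Let $m$ be a positive integer divisible by $6$. Then there exists a $(K,F,Z,S)$-PDA $\mathcal{P}$ with \[K=mK',\quad F=mF',\quad Z=mF'-3g',\quad S=8S'.\]
   Context: A $(K,F,Z,S)$-PDA (placement delivery array) is an $F\times K$ array $\mathcal{P}=[p_{j,k}]$ whose entries are either a special symbol $*$ or integers from $\{1,\dots,S\}$, each integer in $\{1,\dots,S\}$ appearing at least once, such that: (A) the symbol $*$ appears exactly $Z$ times in each column; (B) no integer appears more than once in any row or any column; (C) for any two entries $p_{j_1,k_1}=p_{j_2,k_2}=s\in\{1,\dots,S\}$ with $j_1\ne j_2$ and $k_1\ne k_2$, we have $p_{j_1,k_2}=p_{j_2,k_1}=*$. -}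

module Defs where

open import Data.Nat using (ℕ; zero; suc; _+_)
open import Data.Fin using (Fin; zero; suc)
open import Data.Maybe using (Maybe; just; nothing)
open import Data.Product using (∃; ∃₂; _×_; _,_)
open import Relation.Binary.PropositionalEquality using (_≡_; _≢_)

-- An F × K array: entry at row j, column k. 'nothing' is the symbol *,
-- 'just s' is the integer (toℕ s + 1) ∈ {1,…,S}.
Array : ℕ → ℕ → ℕ → Set
Array F K S = Fin F → Fin K → Maybe (Fin S)

isStar : {S : ℕ} → Maybe (Fin S) → ℕ
isStar nothing  = 1
isStar (just _) = 0

starsInColumn : {F K S : ℕ} → Array F K S → Fin K → ℕ
starsInColumn {zero}  p k = 0
starsInColumn {suc F} p k = isStar (p zero k) + starsInColumn {F} (λ j → p (suc j)) k

record IsPDA (K F Z S : ℕ) (P : Array F K S) : Set where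
  field
    everySymbolUsed : ∀ (s : Fin S) → ∃₂ λ j k → P j k ≡ just s
    condA : ∀ (k : Fin K) → starsInColumn P k ≡ Z
    condB-row : ∀ (j : Fin F) (k₁ k₂ : Fin K) (s : Fin S) →
      P j k₁ ≡ just s → P j k₂ ≡ just s → k₁ ≡ k₂
    condB-col : ∀ (k : Fin K) (j₁ j₂ : Fin F) (s : Fin S) →
      P j₁ k ≡ just s → P j₂ k ≡ just s → j₁ ≡ j₂
    condC : ∀ (j₁ j₂ : Fin F) (k₁ k₂ : Fin K) (s : Fin S) →
      P j₁ k₁ ≡ just s → P j₂ k₂ ≡ just s → j₁ ≢ j₂ → k₁ ≢ k₂ →
      (P j₁ k₂ ≡ nothing) × (P j₂ k₁ ≡ nothing)

PDA : ℕ → ℕ → ℕ → ℕ → Set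
PDA K F Z S = ∃ λ (P : Array F K S) → IsPDA K F Z S P

module Submission where

-- The PDA properties are preserved by the product A ⊗ B whose entry in row (a, j) and
-- column (b, k) is the pair of symbols (A a b, B j k), or * as soon as either entry is *.
-- Each of its columns consists of F₁ blocks: a full block of * for every * in the column
-- of A, a copy of a column of B otherwise; hence it has F₁Z₂ + Z₁(F₂ − Z₂) stars.
-- For m = 6n, the product of the diagonal (n, n, n − 1, 1)-PDA with an explicit
-- (6, 6, 3, 8)-PDA is an (m, m, m − 3, 8)-PDA, and its product with P′ has
-- mZ′ + (m − 3)g′ = mF′ − 3g′ stars in each column.

open import Defs
open import Data.Nat using (ℕ; zero; suc; _+_; _*_; _∸_; _≤_; z≤n; s≤s; NonZero)
open import Data.Nat.Divisibility using (_∣_; divides)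
open import Data.Nat.Properties
  using (+-*-semiring; _≟_; +-assoc; +-identityʳ; *-identityʳ; *-distribˡ-+; *-distribʳ-∸;
         *-monoˡ-≤; +-∸-assoc; +-mono-≤; m+[n∸m]≡n)
open import Data.Bool using (if_then_else_)
open import Data.Fin using (Fin; zero; suc; #_; _↑ˡ_; _↑ʳ_; combine; quotient; remainder)
open import Data.Fin.Properties
  using (all?; any?; remQuot-combine; combine-surjective; combine-injective)
  renaming (_≟_ to _≟ᶠ_)
open import Data.Maybe using (Maybe; just; nothing; zipWith)
open import Data.Maybe.Properties using (≡-dec)
open import Data.Vec using (Vec; []; _∷_; lookup)
open import Data.Product using (∃₂; _×_; _,_; proj₁; proj₂)
open import Function using (_∘_)
open import Relation.Binary.PropositionalEquality
open import Relation.Binary.Definitions using (DecidableEquality)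
open import Relation.Nullary using (Dec; does; yes; no; ¬?; contradiction)
open import Relation.Nullary.Decidable using (map′; toWitness; _→-dec_; _×-dec_)
open import Algebra.Properties.Semiring.Sum +-*-semiring
  using (sum-syntax; sum-cong-≗; ∑-distrib-+; *-distribʳ-sum)

∑-const : ∀ n c → ∑[ i < n ] c ≡ n * c
∑-const zero    c = refl
∑-const (suc n) c = cong (c +_) (∑-const n c)

∑-↑ : ∀ m n (f : Fin (m + n) → ℕ) →
  ∑[ i < m + n ] f i ≡ ∑[ i < m ] f (i ↑ˡ n) + ∑[ i < n ] f (m ↑ʳ i)
∑-↑ zero    n f = refl
∑-↑ (suc m) n f = trans (cong (f zero +_) (∑-↑ m n (f ∘ suc))) (sym (+-assoc (f zero) _ _))

∑-combine : ∀ m n (f : Fin (m * n) → ℕ) →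
  ∑[ i < m * n ] f i ≡ ∑[ a < m ] ∑[ j < n ] f (combine a j)
∑-combine zero    n f = refl
∑-combine (suc m) n f =
  trans (∑-↑ n (m * n) f) (cong (∑[ j < n ] f (j ↑ˡ (m * n)) +_) (∑-combine m n (f ∘ (n ↑ʳ_))))

starsInColumn≡∑ : ∀ {F K S} (P : Array F K S) k → starsInColumn P k ≡ ∑[ j < F ] isStar (P j k)
starsInColumn≡∑ {zero}  P k = refl
starsInColumn≡∑ {suc F} P k = cong (isStar (P zero k) +_) (starsInColumn≡∑ (P ∘ suc) k)

isStar≤1 : ∀ {S} (x : Maybe (Fin S)) → isStar x ≤ 1
isStar≤1 nothing  = s≤s z≤n
isStar≤1 (just _) = z≤n

starsInColumn≤rows : ∀ {F K S} (P : Array F K S) k → starsInColumn P k ≤ F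
starsInColumn≤rows {zero}  P k = z≤n
starsInColumn≤rows {suc F} P k =
  +-mono-≤ (isStar≤1 (P zero k)) (starsInColumn≤rows (P ∘ suc) k)

zipWith-just⁻¹ : ∀ {A B C : Set} (f : A → B → C) (x : Maybe A) (y : Maybe B) {z : C} →
  zipWith f x y ≡ just z → ∃₂ λ a b → x ≡ just a × y ≡ just b × f a b ≡ z
zipWith-just⁻¹ f (just a) (just b) refl = a , b , refl , refl , refl

zipWith-nothingʳ : ∀ {A B C : Set} (f : A → B → C) (x : Maybe A) → zipWith f x nothing ≡ nothing
zipWith-nothingʳ f (just _) = refl
zipWith-nothingʳ f nothing  = refl

∀-combine : ∀ {m n} {P : Fin (m * n) → Set} → (∀ a j → P (combine a j)) → ∀ r → P r
∀-combine {m} {n} p r with a , j , refl ← combine-surjective {m} {n} r = p a j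

module _ {F₁ K₁ S₁ F₂ K₂ S₂ : ℕ} where

  _⊗_ : Array F₁ K₁ S₁ → Array F₂ K₂ S₂ → Array (F₁ * F₂) (K₁ * K₂) (S₁ * S₂)
  (A ⊗ B) r c = zipWith combine (A (quotient {F₁} F₂ r) (quotient {K₁} K₂ c))
                                (B (remainder {F₁} F₂ r) (remainder {K₁} K₂ c))

  ⊗-combine : ∀ (A : Array F₁ K₁ S₁) (B : Array F₂ K₂ S₂) a j b k →
    (A ⊗ B) (combine a j) (combine b k) ≡ zipWith combine (A a b) (B j k)
  ⊗-combine A B a j b k = cong₂ (zipWith combine)
    (cong₂ A (cong proj₁ (remQuot-combine a j)) (cong proj₁ (remQuot-combine b k)))
    (cong₂ B (cong proj₂ (remQuot-combine a j)) (cong proj₂ (remQuot-combine b k)))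

  isStar-zipWith-just : ∀ t (y : Maybe (Fin S₂)) → isStar (zipWith combine (just {A = Fin S₁} t) y) ≡ isStar y
  isStar-zipWith-just t (just _) = refl
  isStar-zipWith-just t nothing  = refl

  starsInBlock : ∀ (B : Array F₂ K₂ S₂) k (x : Maybe (Fin S₁)) →
    ∑[ j < F₂ ] isStar (zipWith combine x (B j k)) ≡
      starsInColumn B k + isStar x * (F₂ ∸ starsInColumn B k)
  starsInBlock B k nothing = begin
    ∑[ j < F₂ ] 1                                        ≡⟨ ∑-const F₂ 1 ⟩
    F₂ * 1                                               ≡⟨ *-identityʳ F₂ ⟩
    F₂                                                   ≡⟨ m+[n∸m]≡n (starsInColumn≤rows B k) ⟨
    starsInColumn B k + (F₂ ∸ starsInColumn B k)         ≡⟨ cong (starsInColumn B k +_) (+-identityʳ _) ⟨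
    starsInColumn B k + 1 * (F₂ ∸ starsInColumn B k)     ∎
    where open ≡-Reasoning
  starsInBlock B k (just t) = begin
    ∑[ j < F₂ ] isStar (zipWith combine (just t) (B j k)) ≡⟨ sum-cong-≗ (λ j → isStar-zipWith-just t (B j k)) ⟩
    ∑[ j < F₂ ] isStar (B j k)                            ≡⟨ starsInColumn≡∑ B k ⟨
    starsInColumn B k                                     ≡⟨ +-identityʳ _ ⟨
    starsInColumn B k + 0 * (F₂ ∸ starsInColumn B k)      ∎
    where open ≡-Reasoning

  starsInColumn-⊗ : ∀ (A : Array F₁ K₁ S₁) (B : Array F₂ K₂ S₂) b k →
    starsInColumn (A ⊗ B) (combine b k) ≡
      F₁ * starsInColumn B k + starsInColumn A b * (F₂ ∸ starsInColumn B k)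
  starsInColumn-⊗ A B b k = begin
    starsInColumn (A ⊗ B) (combine b k)
      ≡⟨ starsInColumn≡∑ (A ⊗ B) (combine b k) ⟩
    ∑[ r < F₁ * F₂ ] isStar ((A ⊗ B) r (combine b k))
      ≡⟨ ∑-combine F₁ F₂ _ ⟩
    ∑[ a < F₁ ] ∑[ j < F₂ ] isStar ((A ⊗ B) (combine a j) (combine b k))
      ≡⟨ sum-cong-≗ (λ a → trans (sum-cong-≗ (λ j → cong isStar (⊗-combine A B a j b k)))
                                 (starsInBlock B k (A a b))) ⟩
    ∑[ a < F₁ ] (Z₂ + isStar (A a b) * (F₂ ∸ Z₂))
      ≡⟨ ∑-distrib-+ (λ _ → Z₂) (λ a → isStar (A a b) * (F₂ ∸ Z₂)) ⟩
    ∑[ a < F₁ ] Z₂ + ∑[ a < F₁ ] (isStar (A a b) * (F₂ ∸ Z₂))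
      ≡⟨ cong₂ _+_ (∑-const F₁ Z₂) (sym (*-distribʳ-sum (F₂ ∸ Z₂) (λ a → isStar (A a b)))) ⟩
    F₁ * Z₂ + ∑[ a < F₁ ] isStar (A a b) * (F₂ ∸ Z₂)
      ≡⟨ cong (λ n → F₁ * Z₂ + n * (F₂ ∸ Z₂)) (starsInColumn≡∑ A b) ⟨
    F₁ * Z₂ + starsInColumn A b * (F₂ ∸ Z₂) ∎
    where
    open ≡-Reasoning
    Z₂ = starsInColumn B k

  ⊗-just⁻¹ : ∀ (A : Array F₁ K₁ S₁) (B : Array F₂ K₂ S₂) a j b k {u} →
    (A ⊗ B) (combine a j) (combine b k) ≡ just u →
    ∃₂ λ t s → A a b ≡ just t × B j k ≡ just s × combine t s ≡ u
  ⊗-just⁻¹ A B a j b k e = zipWith-just⁻¹ combine (A a b) (B j k) (trans (sym (⊗-combine A B a j b k)) e)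

  ⊗-sameSymbol : ∀ (A : Array F₁ K₁ S₁) (B : Array F₂ K₂ S₂) a₁ j₁ b₁ k₁ a₂ j₂ b₂ k₂ {u} →
    (A ⊗ B) (combine a₁ j₁) (combine b₁ k₁) ≡ just u →
    (A ⊗ B) (combine a₂ j₂) (combine b₂ k₂) ≡ just u →
    ∃₂ λ t s → (A a₁ b₁ ≡ just t × A a₂ b₂ ≡ just t) × (B j₁ k₁ ≡ just s × B j₂ k₂ ≡ just s)
  ⊗-sameSymbol A B a₁ j₁ b₁ k₁ a₂ j₂ b₂ k₂ e₁ e₂
    with t₁ , s₁ , x₁ , y₁ , refl ← ⊗-just⁻¹ A B a₁ j₁ b₁ k₁ e₁
       | t₂ , s₂ , x₂ , y₂ , t₂s₂≡t₁s₁ ← ⊗-just⁻¹ A B a₂ j₂ b₂ k₂ e₂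
    with refl , refl ← combine-injective t₂ s₂ t₁ s₁ t₂s₂≡t₁s₁
    = t₁ , s₁ , (x₁ , x₂) , (y₁ , y₂)

  ⊗-nothingˡ : ∀ (A : Array F₁ K₁ S₁) (B : Array F₂ K₂ S₂) a j b k →
    A a b ≡ nothing → (A ⊗ B) (combine a j) (combine b k) ≡ nothing
  ⊗-nothingˡ A B a j b k e = trans (⊗-combine A B a j b k) (cong (λ x → zipWith combine x (B j k)) e)

  ⊗-nothingʳ : ∀ (A : Array F₁ K₁ S₁) (B : Array F₂ K₂ S₂) a j b k →
    B j k ≡ nothing → (A ⊗ B) (combine a j) (combine b k) ≡ nothing
  ⊗-nothingʳ A B a j b k e =
    trans (⊗-combine A B a j b k) (trans (cong (zipWith combine (A a b)) e) (zipWith-nothingʳ combine (A a b)))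

  module _ {Z₁ Z₂ : ℕ} {A : Array F₁ K₁ S₁} {B : Array F₂ K₂ S₂}
           (HA : IsPDA K₁ F₁ Z₁ S₁ A) (HB : IsPDA K₂ F₂ Z₂ S₂ B) where
    private
      module HA = IsPDA HA
      module HB = IsPDA HB

    ⊗-everySymbolUsed : ∀ u → ∃₂ λ r c → (A ⊗ B) r c ≡ just u
    ⊗-everySymbolUsed = ∀-combine λ t s →
      let a , b , Aab≡t = HA.everySymbolUsed t
          j , k , Bjk≡s = HB.everySymbolUsed s
      in combine a j , combine b k , trans (⊗-combine A B a j b k) (cong₂ (zipWith combine) Aab≡t Bjk≡s)

    ⊗-condB-row : ∀ r c₁ c₂ u → (A ⊗ B) r c₁ ≡ just u → (A ⊗ B) r c₂ ≡ just u → c₁ ≡ c₂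
    ⊗-condB-row = ∀-combine λ a j → ∀-combine λ b₁ k₁ → ∀-combine λ b₂ k₂ u e₁ e₂ →
      let t , s , (x₁ , x₂) , (y₁ , y₂) = ⊗-sameSymbol A B a j b₁ k₁ a j b₂ k₂ e₁ e₂
      in cong₂ combine (HA.condB-row a b₁ b₂ t x₁ x₂) (HB.condB-row j k₁ k₂ s y₁ y₂)

    ⊗-condB-col : ∀ c r₁ r₂ u → (A ⊗ B) r₁ c ≡ just u → (A ⊗ B) r₂ c ≡ just u → r₁ ≡ r₂
    ⊗-condB-col = ∀-combine λ b k → ∀-combine λ a₁ j₁ → ∀-combine λ a₂ j₂ u e₁ e₂ →
      let t , s , (x₁ , x₂) , (y₁ , y₂) = ⊗-sameSymbol A B a₁ j₁ b k a₂ j₂ b k e₁ e₂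
      in cong₂ combine (HA.condB-col b a₁ a₂ t x₁ x₂) (HB.condB-col k j₁ j₂ s y₁ y₂)

    ⊗-condC-combine : ∀ a₁ j₁ a₂ j₂ b₁ k₁ b₂ k₂ {u} →
      (A ⊗ B) (combine a₁ j₁) (combine b₁ k₁) ≡ just u → (A ⊗ B) (combine a₂ j₂) (combine b₂ k₂) ≡ just u →
      combine a₁ j₁ ≢ combine a₂ j₂ → combine b₁ k₁ ≢ combine b₂ k₂ →
      ((A ⊗ B) (combine a₁ j₁) (combine b₂ k₂) ≡ nothing) ×
      ((A ⊗ B) (combine a₂ j₂) (combine b₁ k₁) ≡ nothing)
    ⊗-condC-combine a₁ j₁ a₂ j₂ b₁ k₁ b₂ k₂ e₁ e₂ r₁≢r₂ c₁≢c₂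
      with t , s , (x₁ , x₂) , (y₁ , y₂) ← ⊗-sameSymbol A B a₁ j₁ b₁ k₁ a₂ j₂ b₂ k₂ e₁ e₂ | a₁ ≟ᶠ a₂
    ... | yes refl with refl ← HA.condB-row a₁ b₁ b₂ t x₁ x₂ =
      let B₁₂≡* , B₂₁≡* = HB.condC j₁ j₂ k₁ k₂ s y₁ y₂
                            (r₁≢r₂ ∘ cong (combine a₁)) (c₁≢c₂ ∘ cong (combine b₁))
      in ⊗-nothingʳ A B a₁ j₁ b₁ k₂ B₁₂≡* , ⊗-nothingʳ A B a₁ j₂ b₁ k₁ B₂₁≡*
    ... | no a₁≢a₂ =
      let A₁₂≡* , A₂₁≡* = HA.condC a₁ a₂ b₁ b₂ t x₁ x₂
                            a₁≢a₂ λ { refl → a₁≢a₂ (HA.condB-col b₁ a₁ a₂ t x₁ x₂) }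
      in ⊗-nothingˡ A B a₁ j₁ b₂ k₂ A₁₂≡* , ⊗-nothingˡ A B a₂ j₂ b₁ k₁ A₂₁≡*

    ⊗-condC : ∀ r₁ r₂ c₁ c₂ u → (A ⊗ B) r₁ c₁ ≡ just u → (A ⊗ B) r₂ c₂ ≡ just u →
      r₁ ≢ r₂ → c₁ ≢ c₂ → ((A ⊗ B) r₁ c₂ ≡ nothing) × ((A ⊗ B) r₂ c₁ ≡ nothing)
    ⊗-condC = ∀-combine λ a₁ j₁ → ∀-combine λ a₂ j₂ → ∀-combine λ b₁ k₁ → ∀-combine λ b₂ k₂ _ →
      ⊗-condC-combine a₁ j₁ a₂ j₂ b₁ k₁ b₂ k₂

    ⊗-condA : ∀ {Z} → (Z₂ ≤ F₂ → Z ≡ F₁ * Z₂ + Z₁ * (F₂ ∸ Z₂)) → ∀ c → starsInColumn (A ⊗ B) c ≡ Z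
    ⊗-condA {Z} hZ = ∀-combine λ b k → begin
      starsInColumn (A ⊗ B) (combine b k)
        ≡⟨ starsInColumn-⊗ A B b k ⟩
      F₁ * starsInColumn B k + starsInColumn A b * (F₂ ∸ starsInColumn B k)
        ≡⟨ cong₂ (λ z₁ z₂ → F₁ * z₂ + z₁ * (F₂ ∸ z₂)) (HA.condA b) (HB.condA k) ⟩
      F₁ * Z₂ + Z₁ * (F₂ ∸ Z₂)
        ≡⟨ hZ (subst (_≤ F₂) (HB.condA k) (starsInColumn≤rows B k)) ⟨
      Z ∎
      where open ≡-Reasoning

    ⊗-isPDA : ∀ {Z} → (Z₂ ≤ F₂ → Z ≡ F₁ * Z₂ + Z₁ * (F₂ ∸ Z₂)) →
      IsPDA (K₁ * K₂) (F₁ * F₂) Z (S₁ * S₂) (A ⊗ B)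
    ⊗-isPDA hZ = record
      { everySymbolUsed = ⊗-everySymbolUsed
      ; condA           = ⊗-condA hZ
      ; condB-row       = ⊗-condB-row
      ; condB-col       = ⊗-condB-col
      ; condC           = ⊗-condC
      }

-- Z₂ ≤ F₂ holds as soon as B has a column; without columns every Z is correct.
PDA-⊗ : ∀ {K₁ F₁ Z₁ S₁ K₂ F₂ Z₂ S₂ Z} → PDA K₁ F₁ Z₁ S₁ → PDA K₂ F₂ Z₂ S₂ →
  (Z₂ ≤ F₂ → Z ≡ F₁ * Z₂ + Z₁ * (F₂ ∸ Z₂)) → PDA (K₁ * K₂) (F₁ * F₂) Z (S₁ * S₂)
PDA-⊗ (A , HA) (B , HB) hZ = A ⊗ B , ⊗-isPDA HA HB hZ

diagonal : ∀ n → Array n n 1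
diagonal n j k = if does (j ≟ᶠ k) then just zero else nothing

diagonal-just⁻¹ : ∀ {n} (j k : Fin n) {s} → diagonal n j k ≡ just s → j ≡ k
diagonal-just⁻¹ j k e with j ≟ᶠ k
... | yes j≡k = j≡k

diagonal-nothing : ∀ {n} (j k : Fin n) → j ≢ k → diagonal n j k ≡ nothing
diagonal-nothing j k j≢k with j ≟ᶠ k
... | yes j≡k = contradiction j≡k j≢k
... | no _    = refl

∑-stars-diagonal : ∀ n (k : Fin (suc n)) → ∑[ j < suc n ] isStar (diagonal (suc n) j k) ≡ n
∑-stars-diagonal n       zero    = trans (∑-const n 1) (*-identityʳ n)
∑-stars-diagonal (suc n) (suc k) = cong suc (∑-stars-diagonal n k)

diagonal-isPDA : ∀ n → IsPDA (suc n) (suc n) n 1 (diagonal (suc n))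
diagonal-isPDA n = record
  { everySymbolUsed = λ { zero → zero , zero , refl }
  ; condA           = λ k → trans (starsInColumn≡∑ (diagonal (suc n)) k) (∑-stars-diagonal n k)
  ; condB-row       = λ j k₁ k₂ s e₁ e₂ → trans (sym (diagonal-just⁻¹ j k₁ e₁)) (diagonal-just⁻¹ j k₂ e₂)
  ; condB-col       = λ k j₁ j₂ s e₁ e₂ → trans (diagonal-just⁻¹ j₁ k e₁) (sym (diagonal-just⁻¹ j₂ k e₂))
  ; condC           = λ j₁ j₂ k₁ k₂ s e₁ e₂ j₁≢j₂ _ →
      diagonal-nothing j₁ k₂ (λ j₁≡k₂ → j₁≢j₂ (trans j₁≡k₂ (sym (diagonal-just⁻¹ j₂ k₂ e₂)))) ,
      diagonal-nothing j₂ k₁ (λ j₂≡k₁ → j₁≢j₂ (trans (diagonal-just⁻¹ j₁ k₁ e₁) (sym j₂≡k₁)))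
  }

isPDA? : ∀ {K F Z S} (P : Array F K S) → Dec (IsPDA K F Z S P)
isPDA? {Z = Z} {S = S} P =
  map′ (λ (u , a , r , c , x) → record
         { everySymbolUsed = u ; condA = a ; condB-row = r ; condB-col = c ; condC = x })
       (λ H → let open IsPDA H in everySymbolUsed , condA , condB-row , condB-col , condC)
       (  all? (λ s → any? λ j → any? λ k → P j k ≟ᴹ just s)
   ×-dec all? (λ k → starsInColumn P k ≟ Z)
   ×-dec all? (λ j → all? λ k₁ → all? λ k₂ → all? λ s →
           (P j k₁ ≟ᴹ just s) →-dec (P j k₂ ≟ᴹ just s) →-dec (k₁ ≟ᶠ k₂))
   ×-dec all? (λ k → all? λ j₁ → all? λ j₂ → all? λ s →
           (P j₁ k ≟ᴹ just s) →-dec (P j₂ k ≟ᴹ just s) →-dec (j₁ ≟ᶠ j₂))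
   ×-dec all? (λ j₁ → all? λ j₂ → all? λ k₁ → all? λ k₂ → all? λ s →
           (P j₁ k₁ ≟ᴹ just s) →-dec (P j₂ k₂ ≟ᴹ just s) →-dec
           ¬? (j₁ ≟ᶠ j₂) →-dec ¬? (k₁ ≟ᶠ k₂) →-dec
           ((P j₁ k₂ ≟ᴹ nothing) ×-dec (P j₂ k₁ ≟ᴹ nothing))))
  where
  _≟ᴹ_ : DecidableEquality (Maybe (Fin S))
  _≟ᴹ_ = ≡-dec _≟ᶠ_

sixBySix : Array 6 6 8
sixBySix j k = lookup (lookup rows j) k
  where
  rows : Vec (Vec (Maybe (Fin 8)) 6) 6
  rows =
      (nothing    ∷ nothing    ∷ nothing    ∷ nothing    ∷ nothing    ∷ nothing    ∷ [])
    ∷ (nothing    ∷ nothing    ∷ nothing    ∷ nothing    ∷ just (# 0) ∷ just (# 1) ∷ [])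
    ∷ (nothing    ∷ just (# 0) ∷ just (# 2) ∷ just (# 3) ∷ nothing    ∷ just (# 4) ∷ [])
    ∷ (just (# 0) ∷ nothing    ∷ just (# 5) ∷ just (# 6) ∷ nothing    ∷ just (# 7) ∷ [])
    ∷ (just (# 2) ∷ just (# 5) ∷ nothing    ∷ just (# 1) ∷ just (# 4) ∷ nothing    ∷ [])
    ∷ (just (# 3) ∷ just (# 6) ∷ just (# 1) ∷ nothing    ∷ just (# 7) ∷ nothing    ∷ [])
    ∷ []

sixBySix-isPDA : IsPDA 6 6 3 8 sixBySix
sixBySix-isPDA = toWitness {a? = isPDA? sixBySix} _

PDA-6[1+q] : ∀ q → PDA (suc q * 6) (suc q * 6) (suc q * 6 ∸ 3) 8
PDA-6[1+q] q = PDA-⊗ (diagonal (suc q) , diagonal-isPDA q) (sixBySix , sixBySix-isPDA) λ _ →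
  cong (3 +_) (*-distribˡ-+ q 3 3)

*-+-∸ : ∀ m z g {c} → c ≤ m → m * (z + g) ∸ c * g ≡ m * z + (m ∸ c) * g
*-+-∸ m z g {c} c≤m = begin
  m * (z + g) ∸ c * g     ≡⟨ cong (_∸ c * g) (*-distribˡ-+ m z g) ⟩
  m * z + m * g ∸ c * g   ≡⟨ +-∸-assoc (m * z) (*-monoˡ-≤ g c≤m) ⟩
  m * z + (m * g ∸ c * g) ≡⟨ cong (m * z +_) (*-distribʳ-∸ g m c) ⟨
  m * z + (m ∸ c) * g     ∎
  where open ≡-Reasoning

theorem3 : ∀ (K′ F′ Z′ S′ : ℕ) → PDA K′ F′ Z′ S′ →
    ∀ (m : ℕ) → NonZero m → 6 ∣ m →
    PDA (m * K′) (m * F′) (m * F′ ∸ 3 * (F′ ∸ Z′)) (8 * S′)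
theorem3 K′ F′ Z′ S′ P m () (divides zero refl)
theorem3 K′ F′ Z′ S′ P m _ (divides (suc q) refl) = PDA-⊗ (PDA-6[1+q] q) P λ Z′≤F′ → begin
  m * F′ ∸ 3 * (F′ ∸ Z′)               ≡⟨ cong (λ f → m * f ∸ 3 * (F′ ∸ Z′)) (m+[n∸m]≡n Z′≤F′) ⟨
  m * (Z′ + (F′ ∸ Z′)) ∸ 3 * (F′ ∸ Z′) ≡⟨ *-+-∸ m Z′ (F′ ∸ Z′) (s≤s (s≤s (s≤s z≤n))) ⟩
  m * Z′ + (m ∸ 3) * (F′ ∸ Z′)         ∎
  where open ≡-Reasoning
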